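{- If $[x_0,x_1,\dots,x_{m-1}]$ is a topdrop-valid necklace in $S_n$, then $$\sigma_{n,x_{m-1}}\,\sigma_{n,x_{m-2}}\cdots\sigma_{n,x_0}=e,$$ where $e$ is the identity permutation.
   Context: Permutations are in one-line notation $\pi=\pi_1\cdots\pi_n$. The topdrop map $T:S_n\to S_n$ is $T(\pi_1\cdots\pi_n)=\pi_{\pi_1+1}\cdots\pi_n\,\pi_{\pi_1}\pi_{\pi_1-1}\cdots\pi_1$ (first $\pi_1$ entries removed, reversed, appended at the end); it is a bijection. The topdrop-necklace of $\pi$ is the cyclic sequence $[\pi_1,T(\pi)_1,\dots,T^{s-1}(\pi)_1]$, where $s\ge1$ is minimal with $T^s(\pi)=\pi$, considered up to cyclic rotation; a necklace is topdrop-valid in $S_n$ if it is the topdrop-necklace of some $\pi\in S_n$. For natural numbers $p\le n$, $\sigma_{n,p}\in S_n$ is the permutation with $\sigma_{n,p}(j)=n+1-j$ for $1\le j\le p$ and $\sigma_{n,p}(j)=j-p$ for $p+1\le j\le n$. Products are compositions of functions, applied right to left. -}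

module Defs where

open import Data.Nat using (ℕ; zero; suc; _+_; _∸_; _≤_; _<_; _≤ᵇ_)
open import Data.Bool using (if_then_else_)
open import Data.List using (List; []; _∷_; _++_; drop; take; reverse; map; upTo)
open import Data.Product using (Σ; ∃; _×_)
open import Relation.Binary.PropositionalEquality using (_≡_; _≢_)
open import Relation.Binary.Construct.Closure.ReflexiveTransitive using ()
open import Data.List.Relation.Binary.Permutation.Propositional using (_↭_)
open import Function using (_∘_; id)

-- Permutations of S_n in one-line notation: lists of naturals that are a
-- rearrangement of [1, 2, ..., n].
oneToN : ℕ → List ℕ
oneToN n = map suc (upTo n)

IsPerm : ℕ → List ℕ → Set
IsPerm n π = π ↭ oneToN n

topdrop : List ℕ → List ℕ
topdrop [] = []
topdrop (x ∷ xs) = drop x (x ∷ xs) ++ reverse (take x (x ∷ xs))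

topdrop^ : ℕ → List ℕ → List ℕ
topdrop^ zero π = π
topdrop^ (suc k) π = topdrop (topdrop^ k π)

-- first entry (π is nonempty whenever n ≥ 1; default 0 only for the empty list)
first : List ℕ → ℕ
first [] = 0
first (x ∷ _) = x

IsPeriod : List ℕ → ℕ → Set
IsPeriod π s = (1 ≤ s) × (topdrop^ s π ≡ π) ×
               (∀ t → 1 ≤ t → t < s → topdrop^ t π ≢ π)

necklaceList : List ℕ → ℕ → List ℕ
necklaceList π s = map (λ i → first (topdrop^ i π)) (upTo s)

IsRotation : List ℕ → List ℕ → Set
IsRotation xs ys = ∃ λ k → xs ≡ drop k ys ++ take k ys

-- A necklace (given by any representative list) is topdrop-valid in S_n
TopdropValid : ℕ → List ℕ → Set
TopdropValid n xs = ∃ λ π → IsPerm n π × ∃ λ s → IsPeriod π s × IsRotation xs (necklaceList π s)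

σ : ℕ → ℕ → ℕ → ℕ
σ n p j = if j ≤ᵇ p then suc n ∸ j else j ∸ p

-- σ_{n,x_{m-1}} ∘ ⋯ ∘ σ_{n,x_0}  (σ_{n,x_0} applied first)
σProd : ℕ → List ℕ → ℕ → ℕ
σProd n [] = id
σProd n (x ∷ xs) = σProd n xs ∘ σ n x

{-# OPTIONS --safe #-}
-- If p = π₁, then σ_{n,p} maps each position j of π to the position of the entry π_j in T(π):
-- the first p entries are reversed to the end (j ↦ n+1-j) and the others move left by p (j ↦ j-p).
-- Following the necklace of π, σ_{n,x_{s-1}} ⋯ σ_{n,x_0} therefore maps j to the position of π_j
-- in T^s(π) = π, which is j because the entries of π are distinct. A rotation of the necklace of π
-- by k is the necklace of T^k(π), which has the same period.
module Submission where

open import Defs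
open import Data.Bool using (true; false)
open import Data.Empty using (⊥-elim)
open import Data.List using (List; []; _∷_; _++_; _∷ʳ_; drop; take; reverse; map; upTo; applyUpTo; length)
open import Data.List.Properties
  using (length-++; length-take; length-drop; length-reverse; length-map; length-upTo;
         unfold-reverse; take++drop≡id; map-upTo; map-∘; map-cong)
open import Data.List.Relation.Unary.All using (All; _∷_)
open import Data.List.Relation.Unary.AllPairs using (_∷_)
open import Data.List.Relation.Unary.Unique.Propositional using (Unique)
import Data.List.Relation.Unary.Unique.Propositional.Properties as Unique
open import Data.List.Relation.Binary.Permutation.Propositional
  using (_↭_; ↭-refl; ↭-reflexive; ↭-sym; ↭-trans; ↭⇒↭ₛ)
open import Data.List.Relation.Binary.Permutation.Propositional.Properties
  using (↭-length; ++⁺ˡ; ++-comm; ↭-reverse)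
open import Data.List.Relation.Binary.Permutation.Setoid.Properties using (Unique-resp-↭)
open import Data.Nat using (ℕ; zero; suc; _≤_; _+_; _∸_; _<_; _≤ᵇ_; _⊓_; pred; >-nonZero; z≤n; s≤s; z<s; s≤s⁻¹)
open import Data.Nat.Properties
open import Data.Product using (_×_; _,_; ∃; proj₁)
open import Data.Sum using (inj₁; inj₂)
open import Function using (_∘_)
open import Relation.Binary.PropositionalEquality
  using (_≡_; refl; sym; trans; cong; cong₂; subst; setoid; module ≡-Reasoning)
open import Relation.Nullary using (contradiction)

open ≡-Reasoning

InRange : ℕ → ℕ → Set
InRange n j = 1 ≤ j × j ≤ n

σ-≤ : ∀ n {p j} → j ≤ p → σ n p j ≡ suc n ∸ j
σ-≤ n {p} {j} j≤p with j ≤ᵇ p | ≤⇒≤ᵇ j≤p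
... | true | _ = refl

σ-> : ∀ n {p j} → p < j → σ n p j ≡ j ∸ p
σ-> n {p} {j} p<j with j ≤ᵇ p | ≤ᵇ⇒≤ j p
... | false | _   = refl
... | true  | j≤p = contradiction (j≤p _) (<⇒≱ p<j)

σ-inRange : ∀ {n p j} → InRange n j → InRange n (σ n p j)
σ-inRange {n} {p} {j} (1≤j , j≤n) with ≤-<-connex j p
... | inj₁ j≤p rewrite σ-≤ n j≤p = m<n⇒0<n∸m (s≤s j≤n) , ∸-monoʳ-≤ (suc n) 1≤j
... | inj₂ p<j rewrite σ-> n p<j = m<n⇒0<n∸m p<j , ≤-trans (m∸n≤m j p) j≤n

σProd-inRange : ∀ {n} xs {j} → InRange n j → InRange n (σProd n xs j)
σProd-inRange []       r = r
σProd-inRange (x ∷ xs) r = σProd-inRange xs (σ-inRange r)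

-- 0-indexed lookup with junk value 0 out of range, so the paper's π_j is entry π (pred j).
entry : List ℕ → ℕ → ℕ
entry []       _       = 0
entry (x ∷ _)  zero    = x
entry (_ ∷ xs) (suc i) = entry xs i

entry-++ˡ : ∀ xs {ys i} → i < length xs → entry (xs ++ ys) i ≡ entry xs i
entry-++ˡ (x ∷ xs) {i = zero}  _         = refl
entry-++ˡ (x ∷ xs) {i = suc i} (s≤s i<n) = entry-++ˡ xs i<n

entry-++ʳ : ∀ xs {ys} i → entry (xs ++ ys) (length xs + i) ≡ entry ys i
entry-++ʳ []       i = refl
entry-++ʳ (x ∷ xs) i = entry-++ʳ xs i

entry-∷ʳ : ∀ xs x → entry (xs ∷ʳ x) (length xs) ≡ x
entry-∷ʳ []       x = refl
entry-∷ʳ (_ ∷ xs) x = entry-∷ʳ xs x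

entry-drop : ∀ p xs i → entry (drop p xs) i ≡ entry xs (p + i)
entry-drop zero    xs       i = refl
entry-drop (suc p) []       i = refl
entry-drop (suc p) (x ∷ xs) i = entry-drop p xs i

entry-take : ∀ p xs {i} → i < p → entry (take p xs) i ≡ entry xs i
entry-take (suc p) []       _         = refl
entry-take (suc p) (x ∷ xs) {zero}  _         = refl
entry-take (suc p) (x ∷ xs) {suc i} (s≤s i<p) = entry-take p xs i<p

entry-reverse : ∀ xs {i} → i < length xs → entry (reverse xs) (length xs ∸ suc i) ≡ entry xs i
entry-reverse (x ∷ xs) {zero} _ = begin
  entry (reverse (x ∷ xs)) (length xs)          ≡⟨ cong (λ ys → entry ys (length xs)) (unfold-reverse x xs) ⟩
  entry (reverse xs ∷ʳ x) (length xs)           ≡⟨ cong (entry (reverse xs ∷ʳ x)) (length-reverse xs) ⟨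
  entry (reverse xs ∷ʳ x) (length (reverse xs)) ≡⟨ entry-∷ʳ (reverse xs) x ⟩
  x                                             ∎
entry-reverse (x ∷ xs) {suc i} (s≤s i<n) = begin
  entry (reverse (x ∷ xs)) (length xs ∸ suc i) ≡⟨ cong (λ ys → entry ys (length xs ∸ suc i)) (unfold-reverse x xs) ⟩
  entry (reverse xs ∷ʳ x) (length xs ∸ suc i)  ≡⟨ entry-++ˡ (reverse xs) inBounds ⟩
  entry (reverse xs) (length xs ∸ suc i)       ≡⟨ entry-reverse xs i<n ⟩
  entry xs i                                   ∎
  where
  inBounds : length xs ∸ suc i < length (reverse xs)
  inBounds = subst (length xs ∸ suc i <_) (sym (length-reverse xs)) (∸-monoʳ-< z<s i<n)

All-entry : ∀ {P : ℕ → Set} {xs i} → All P xs → i < length xs → P (entry xs i)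
All-entry {i = zero}  (px ∷ _)   _         = px
All-entry {i = suc i} (_ ∷ pxs) (s≤s i<n) = All-entry pxs i<n

entry-injective : ∀ {xs a b} → Unique xs → a < length xs → b < length xs →
                  entry xs a ≡ entry xs b → a ≡ b
entry-injective {a = zero}  {zero}  _ _ _ _ = refl
entry-injective {a = zero}  {suc b} (x≢xs ∷ _) _ (s≤s b<n) eq = ⊥-elim (All-entry x≢xs b<n eq)
entry-injective {a = suc a} {zero}  (x≢xs ∷ _) (s≤s a<n) _ eq = ⊥-elim (All-entry x≢xs a<n (sym eq))
entry-injective {a = suc a} {suc b} (_ ∷ u) (s≤s a<n) (s≤s b<n) eq =
  cong suc (entry-injective u a<n b<n eq)

entry-reversedPrefix : ∀ p xs {i} → i < p → i < length xs →
  entry (drop p xs ++ reverse (take p xs)) (length xs ∸ suc i) ≡ entry xs i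
entry-reversedPrefix p xs {i} i<p i<n = begin
  entry (D ++ reverse P) (length xs ∸ suc i)             ≡⟨ cong (entry (D ++ reverse P)) position ⟩
  entry (D ++ reverse P) (length D + (length P ∸ suc i)) ≡⟨ entry-++ʳ D (length P ∸ suc i) ⟩
  entry (reverse P) (length P ∸ suc i)                   ≡⟨ entry-reverse P i<|P| ⟩
  entry P i                                              ≡⟨ entry-take p xs i<p ⟩
  entry xs i                                             ∎
  where
  P = take p xs
  D = drop p xs
  i<|P| : i < length P
  i<|P| = subst (i <_) (sym (length-take p xs)) (⊓-glb i<p i<n)
  position : length xs ∸ suc i ≡ length D + (length P ∸ suc i)
  position = begin
    length xs ∸ suc i               ≡⟨ cong (λ ys → length ys ∸ suc i) (take++drop≡id p xs) ⟨
    length (P ++ D) ∸ suc i         ≡⟨ cong (_∸ suc i) (trans (length-++ P) (+-comm (length P) (length D))) ⟩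
    length D + length P ∸ suc i     ≡⟨ +-∸-assoc (length D) i<|P| ⟩
    length D + (length P ∸ suc i)   ∎

entry-shiftedSuffix : ∀ p xs {i} → p ≤ i → i < length xs →
  entry (drop p xs ++ reverse (take p xs)) (i ∸ p) ≡ entry xs i
entry-shiftedSuffix p xs {i} p≤i i<n = begin
  entry (drop p xs ++ reverse (take p xs)) (i ∸ p) ≡⟨ entry-++ˡ (drop p xs) inBounds ⟩
  entry (drop p xs) (i ∸ p)                        ≡⟨ entry-drop p xs (i ∸ p) ⟩
  entry xs (p + (i ∸ p))                           ≡⟨ cong (entry xs) (m+[n∸m]≡n p≤i) ⟩
  entry xs i                                       ∎
  where
  inBounds : i ∸ p < length (drop p xs)
  inBounds = subst (i ∸ p <_) (sym (length-drop p xs)) (∸-monoˡ-< i<n p≤i)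

entry-topdrop : ∀ π {n j} → length π ≡ n → InRange n j →
  entry (topdrop π) (pred (σ n (first π) j)) ≡ entry π (pred j)
entry-topdrop π@(x ∷ _) {j = suc i} refl (_ , i<n) with ≤-<-connex (suc i) x
... | inj₁ i<x = begin
  entry (topdrop π) (pred (σ (length π) x (suc i))) ≡⟨ cong (entry (topdrop π) ∘ pred) (σ-≤ (length π) i<x) ⟩
  entry (topdrop π) (pred (length π ∸ i))           ≡⟨ cong (entry (topdrop π)) (pred[m∸n]≡m∸[1+n] (length π) i) ⟩
  entry (topdrop π) (length π ∸ suc i)              ≡⟨ entry-reversedPrefix x π i<x i<n ⟩
  entry π i                                         ∎
... | inj₂ x<1+i = begin
  entry (topdrop π) (pred (σ (length π) x (suc i))) ≡⟨ cong (entry (topdrop π) ∘ pred) (σ-> (length π) x<1+i) ⟩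
  entry (topdrop π) (pred (suc i ∸ x))              ≡⟨ cong (entry (topdrop π)) (pred[m∸n]≡m∸[1+n] (suc i) x) ⟩
  entry (topdrop π) (i ∸ x)                         ≡⟨ entry-shiftedSuffix x π (s≤s⁻¹ x<1+i) i<n ⟩
  entry π i                                         ∎

topdrop-↭ : ∀ π → topdrop π ↭ π
topdrop-↭ []       = ↭-refl
topdrop-↭ π@(x ∷ _) = ↭-trans (++⁺ˡ (drop x π) (↭-reverse (take x π)))
                      (↭-trans (++-comm (drop x π) (take x π)) (↭-reflexive (take++drop≡id x π)))

topdrop^-↭ : ∀ k π → topdrop^ k π ↭ π
topdrop^-↭ zero    π = ↭-refl
topdrop^-↭ (suc k) π = ↭-trans (topdrop-↭ (topdrop^ k π)) (topdrop^-↭ k π)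

topdrop^-+ : ∀ m k π → topdrop^ (m + k) π ≡ topdrop^ m (topdrop^ k π)
topdrop^-+ zero    k π = refl
topdrop^-+ (suc m) k π = cong topdrop (topdrop^-+ m k π)

topdrop^-suc : ∀ k π → topdrop^ (suc k) π ≡ topdrop^ k (topdrop π)
topdrop^-suc k π = trans (cong (λ m → topdrop^ m π) (+-comm 1 k)) (topdrop^-+ k 1 π)

topdrop^-periodic : ∀ {π} s k → topdrop^ s π ≡ π → topdrop^ s (topdrop^ k π) ≡ topdrop^ k π
topdrop^-periodic {π} s k Tˢπ≡π = begin
  topdrop^ s (topdrop^ k π) ≡⟨ topdrop^-+ s k π ⟨
  topdrop^ (s + k) π        ≡⟨ cong (λ m → topdrop^ m π) (+-comm s k) ⟩
  topdrop^ (k + s) π        ≡⟨ topdrop^-+ k s π ⟩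
  topdrop^ k (topdrop^ s π) ≡⟨ cong (topdrop^ k) Tˢπ≡π ⟩
  topdrop^ k π              ∎

IsPerm-topdrop^ : ∀ {n π} k → IsPerm n π → IsPerm n (topdrop^ k π)
IsPerm-topdrop^ {π = π} k π↭ = ↭-trans (topdrop^-↭ k π) π↭

IsPerm⇒length : ∀ {n π} → IsPerm n π → length π ≡ n
IsPerm⇒length {n} π↭ = trans (↭-length π↭) (trans (length-map suc (upTo n)) (length-upTo n))

IsPerm⇒Unique : ∀ {n π} → IsPerm n π → Unique π
IsPerm⇒Unique {n} π↭ =
  Unique-resp-↭ (setoid ℕ) (↭⇒↭ₛ (↭-sym π↭)) (Unique.map⁺ suc-injective (Unique.upTo⁺ n))

necklace-suc : ∀ k π → necklaceList π (suc k) ≡ first π ∷ necklaceList (topdrop π) k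
necklace-suc k π = cong (first π ∷_) (begin
  map f (applyUpTo suc k)  ≡⟨ cong (map f) (map-upTo suc k) ⟨
  map f (map suc (upTo k)) ≡⟨ map-∘ (upTo k) ⟨
  map (f ∘ suc) (upTo k)   ≡⟨ map-cong (λ i → cong first (topdrop^-suc i π)) (upTo k) ⟩
  necklaceList (topdrop π) k ∎)
  where
  f : ℕ → ℕ
  f i = first (topdrop^ i π)

necklace-+ : ∀ m k π → necklaceList π (m + k) ≡ necklaceList π m ++ necklaceList (topdrop^ m π) k
necklace-+ zero    k π = refl
necklace-+ (suc m) k π = begin
  necklaceList π (suc m + k)
    ≡⟨ necklace-suc (m + k) π ⟩
  first π ∷ necklaceList (topdrop π) (m + k)
    ≡⟨ cong (first π ∷_) (necklace-+ m k (topdrop π)) ⟩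
  first π ∷ necklaceList (topdrop π) m ++ necklaceList (topdrop^ m (topdrop π)) k
    ≡⟨ cong₂ (λ ys ρ → ys ++ necklaceList ρ k) (necklace-suc m π) (topdrop^-suc m π) ⟨
  necklaceList π (suc m) ++ necklaceList (topdrop^ (suc m) π) k
    ∎

take-necklace : ∀ k s π → take k (necklaceList π s) ≡ necklaceList π (k ⊓ s)
take-necklace zero    s       π = refl
take-necklace (suc k) zero    π = refl
take-necklace (suc k) (suc s) π = begin
  take (suc k) (necklaceList π (suc s))         ≡⟨ cong (take (suc k)) (necklace-suc s π) ⟩
  first π ∷ take k (necklaceList (topdrop π) s) ≡⟨ cong (first π ∷_) (take-necklace k s (topdrop π)) ⟩
  first π ∷ necklaceList (topdrop π) (k ⊓ s)    ≡⟨ necklace-suc (k ⊓ s) π ⟨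
  necklaceList π (suc k ⊓ suc s)                ∎

drop-necklace : ∀ k s π → drop k (necklaceList π s) ≡ necklaceList (topdrop^ k π) (s ∸ k)
drop-necklace zero    s       π = refl
drop-necklace (suc k) zero    π = refl
drop-necklace (suc k) (suc s) π = begin
  drop (suc k) (necklaceList π (suc s))          ≡⟨ cong (drop (suc k)) (necklace-suc s π) ⟩
  drop k (necklaceList (topdrop π) s)            ≡⟨ drop-necklace k s (topdrop π) ⟩
  necklaceList (topdrop^ k (topdrop π)) (s ∸ k)  ≡⟨ cong (λ ρ → necklaceList ρ (s ∸ k)) (topdrop^-suc k π) ⟨
  necklaceList (topdrop^ (suc k) π) (suc s ∸ suc k) ∎

rotate-necklace : ∀ k s π → drop k (necklaceList π s) ++ take k (necklaceList π s) ≡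
                  necklaceList (topdrop^ k π) (s ∸ k) ++ necklaceList π (k ⊓ s)
rotate-necklace k s π = cong₂ _++_ (drop-necklace k s π) (take-necklace k s π)

rotation⇒necklace : ∀ {xs s π} → topdrop^ s π ≡ π → IsRotation xs (necklaceList π s) →
                    ∃ λ k → xs ≡ necklaceList (topdrop^ k π) s
rotation⇒necklace {xs} {s} {π} Tˢπ≡π (k , xs≡) with ≤-total k s
... | inj₁ k≤s = k , (begin
  xs                                                  ≡⟨ xs≡ ⟩
  drop k L ++ take k L                                ≡⟨ rotate-necklace k s π ⟩
  necklaceList ρ (s ∸ k) ++ necklaceList π (k ⊓ s)    ≡⟨ cong₂ (λ τ m → necklaceList ρ (s ∸ k) ++ necklaceList τ m)
                                                                (sym Tˢ⁻ᵏρ≡π) (m≤n⇒m⊓n≡m k≤s) ⟩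
  necklaceList ρ (s ∸ k) ++ necklaceList (topdrop^ (s ∸ k) ρ) k ≡⟨ necklace-+ (s ∸ k) k ρ ⟨
  necklaceList ρ (s ∸ k + k)                          ≡⟨ cong (necklaceList ρ) (m∸n+n≡m k≤s) ⟩
  necklaceList ρ s                                    ∎)
  where
  L = necklaceList π s
  ρ = topdrop^ k π
  Tˢ⁻ᵏρ≡π : topdrop^ (s ∸ k) ρ ≡ π
  Tˢ⁻ᵏρ≡π = trans (sym (topdrop^-+ (s ∸ k) k π))
                   (trans (cong (λ m → topdrop^ m π) (m∸n+n≡m k≤s)) Tˢπ≡π)
... | inj₂ s≤k = 0 , (begin
  xs                                                              ≡⟨ xs≡ ⟩
  drop k L ++ take k L                                            ≡⟨ rotate-necklace k s π ⟩
  necklaceList (topdrop^ k π) (s ∸ k) ++ necklaceList π (k ⊓ s)   ≡⟨ cong₂ (λ a b → necklaceList (topdrop^ k π) a ++ necklaceList π b)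
                                                                            (m≤n⇒m∸n≡0 s≤k) (m≥n⇒m⊓n≡n s≤k) ⟩
  necklaceList π s                                                ∎)
  where L = necklaceList π s

σProd-necklace-tracks : ∀ k π {n j} → length π ≡ n → InRange n j →
  entry (topdrop^ k π) (pred (σProd n (necklaceList π k) j)) ≡ entry π (pred j)
σProd-necklace-tracks zero    π         _   _ = refl
σProd-necklace-tracks (suc k) π {n} {j} |π| r = begin
  entry (topdrop^ (suc k) π) (pred (σProd n (necklaceList π (suc k)) j))
    ≡⟨ cong₂ (λ ρ ys → entry ρ (pred (σProd n ys j))) (topdrop^-suc k π) (necklace-suc k π) ⟩
  entry (topdrop^ k (topdrop π)) (pred (σProd n (necklaceList (topdrop π) k) (σ n (first π) j)))
    ≡⟨ σProd-necklace-tracks k (topdrop π) (trans (↭-length (topdrop-↭ π)) |π|) (σ-inRange r) ⟩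
  entry (topdrop π) (pred (σ n (first π) j))
    ≡⟨ entry-topdrop π |π| r ⟩
  entry π (pred j)
    ∎

σProd-necklace-fixes : ∀ {n π} s {j} → IsPerm n π → topdrop^ s π ≡ π → InRange n j →
                       σProd n (necklaceList π s) j ≡ j
σProd-necklace-fixes {n} {π} s {j} π↭ Tˢπ≡π r@(1≤j , _) =
  pred-injective ⦃ >-nonZero 1≤σj ⦄ ⦃ >-nonZero 1≤j ⦄
    (entry-injective (IsPerm⇒Unique π↭) (inBounds σj-inRange) (inBounds r) tracked)
  where
  L = necklaceList π s
  σj-inRange : InRange n (σProd n L j)
  σj-inRange = σProd-inRange L r
  1≤σj : 1 ≤ σProd n L j
  1≤σj = proj₁ σj-inRange
  inBounds : ∀ {i} → InRange n i → pred i < length π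
  inBounds (s≤s z≤n , i≤n) = subst (_ <_) (sym (IsPerm⇒length π↭)) i≤n
  tracked : entry π (pred (σProd n L j)) ≡ entry π (pred j)
  tracked = subst (λ ρ → entry ρ (pred (σProd n L j)) ≡ entry π (pred j)) Tˢπ≡π
                  (σProd-necklace-tracks s π (IsPerm⇒length π↭) r)

lemma5p4 : (n : ℕ) (xs : List ℕ) → TopdropValid n xs →
    ∀ j → 1 ≤ j → j ≤ n → σProd n xs j ≡ j
lemma5p4 n xs (π , π↭ , s , (_ , Tˢπ≡π , _) , rotation) j 1≤j j≤n
  with rotation⇒necklace Tˢπ≡π rotation
... | k , refl = σProd-necklace-fixes s (IsPerm-topdrop^ k π↭) (topdrop^-periodic s k Tˢπ≡π) (1≤j , j≤n)
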